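{- Let $Q$ be a uniformly sign-coherent ice quiver whose mutable subquiver is abundant and acyclic with unique acyclic ordering $v_1\prec\dots\prec v_n$. Pick $j\in\{1,\dots,n\}$ and let $Q^j=\mu_{\mathbf w_j}(Q)$ with $\mathbf w_j=[v_1,\dots,v_j]$. If $v_j$ is red in $Q$, then $v_1,\dots,v_{j-1}$ are red vertices and $v_j$ is a green vertex of $Q^j$.
   Context: Quivers have no loops or 2-cycles. An ice quiver has vertices partitioned into mutable and frozen; its mutable subquiver is the full subquiver on mutable vertices. Mutation at a mutable vertex $k$: add an arrow $a\to b$ for each path $a\to k\to b$, reverse all arrows at $k$, remove 2-cycles; $\mu_{[i_1,\dots,i_m]}$ mutates at $i_1$ first, then $i_2$, etc. A mutable vertex $i$ is green if it has at least one arrow to/from a frozen vertex and all such arrows go from $i$ to frozen vertices; red if at least one such arrow and all go from frozen vertices to $i$; blue if none. Uniformly sign-coherent: every ice quiver obtained by mutation sequences has every mutable vertex red, green or blue, and not every mutable vertex of the ice quiver itself is blue. Abundant: at least two arrows between every pair of distinct vertices; acyclic: no directed cycle. An acyclic ordering: total order $\prec$ with $v_i\prec v_j$ whenever $v_i\to v_j$. -}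

module Defs where

open import Data.Nat using (ℕ; zero; suc; _+_; _*_; _∸_; _≤_; _<_)
open import Data.Fin using (Fin; toℕ; inject₁) renaming (suc to fsuc; zero to fzero)
import Data.Fin.Properties as FinP
open import Data.Sum using (_⊎_; inj₁; inj₂)
open import Data.Sum.Properties using (≡-dec)
open import Data.Product using (Σ; ∃; ∃-syntax; _×_; _,_)
open import Data.List using (List; []; _∷_; map; foldl)
open import Data.List.Base using (upTo)
open import Relation.Binary.PropositionalEquality using (_≡_; _≢_)
open import Relation.Nullary using (¬_; yes; no)
open import Function.Definitions using (Injective)

-- An ice quiver with n mutable vertices (inj₁) and m frozen vertices (inj₂),
-- given by arrow multiplicities: arr a b = number of arrows a → b.
Vertex : ℕ → ℕ → Set
Vertex n m = Fin n ⊎ Fin m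

record IceQuiver (n m : ℕ) : Set where
  constructor iceQuiver
  field
    arr : Vertex n m → Vertex n m → ℕ
open IceQuiver public

IsQuiver : ∀ {n m} → IceQuiver n m → Set
IsQuiver Q = (∀ a → arr Q a a ≡ 0) × (∀ a b → 0 < arr Q a b → arr Q b a ≡ 0)

_≟V_ : ∀ {n m} (a b : Vertex n m) → Relation.Nullary.Dec (a ≡ b)
_≟V_ = ≡-dec FinP._≟_ FinP._≟_

-- Mutation at mutable vertex k: for each path a → k → b add an arrow a → b,
-- reverse arrows at k, then cancel 2-cycles.
mutate : ∀ {n m} → Fin n → IceQuiver n m → IceQuiver n m
mutate {n} {m} k Q = iceQuiver f
  where
  A = arr Q
  K : Vertex n m
  K = inj₁ k
  f : Vertex n m → Vertex n m → ℕ
  f a b with a ≟V K | b ≟V K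
  ... | yes _ | _     = A b a
  ... | no _  | yes _ = A b a
  ... | no _  | no _  = (A a b + A a K * A K b) ∸ (A b a + A b K * A K a)

mutateSeq : ∀ {n m} → List (Fin n) → IceQuiver n m → IceQuiver n m
mutateSeq [] Q = Q
mutateSeq (k ∷ ks) Q = mutateSeq ks (mutate k Q)

IsGreen : ∀ {n m} → IceQuiver n m → Fin n → Set
IsGreen Q i = (∃[ f ] (0 < arr Q (inj₁ i) (inj₂ f) ⊎ 0 < arr Q (inj₂ f) (inj₁ i)))
            × (∀ f → arr Q (inj₂ f) (inj₁ i) ≡ 0)

IsRed : ∀ {n m} → IceQuiver n m → Fin n → Set
IsRed Q i = (∃[ f ] (0 < arr Q (inj₁ i) (inj₂ f) ⊎ 0 < arr Q (inj₂ f) (inj₁ i)))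
          × (∀ f → arr Q (inj₁ i) (inj₂ f) ≡ 0)

IsBlue : ∀ {n m} → IceQuiver n m → Fin n → Set
IsBlue Q i = ∀ f → (arr Q (inj₁ i) (inj₂ f) ≡ 0) × (arr Q (inj₂ f) (inj₁ i) ≡ 0)

UniformlySignCoherent : ∀ {n m} → IceQuiver n m → Set
UniformlySignCoherent Q =
  (∀ (ks : List _) i → IsRed (mutateSeq ks Q) i ⊎ IsGreen (mutateSeq ks Q) i ⊎ IsBlue (mutateSeq ks Q) i)
  × ¬ (∀ i → IsBlue Q i)

mArr : ∀ {n m} → IceQuiver n m → Fin n → Fin n → ℕ
mArr Q i j = arr Q (inj₁ i) (inj₁ j)

Abundant : ∀ {n m} → IceQuiver n m → Set
Abundant Q = ∀ i j → i ≢ j → 2 ≤ mArr Q i j + mArr Q j i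

-- a directed cycle of length suc k in the mutable subquiver:
-- c 0 → c 1 → … → c k → c 0
HasDirectedCycle : ∀ {n m} → IceQuiver n m → Set
HasDirectedCycle {n} Q = ∃[ k ] Σ (Fin (suc k) → Fin n) λ c →
  (∀ (i : Fin k) → 0 < mArr Q (c (inject₁ i)) (c (fsuc i)))
  × 0 < mArr Q (c (Data.Fin.fromℕ k)) (c fzero)

Acyclic : ∀ {n m} → IceQuiver n m → Set
Acyclic Q = ¬ HasDirectedCycle Q

-- an acyclic ordering v₁ ≺ … ≺ vₙ of the mutable vertices, given as an
-- enumeration v : Fin n → Fin n (v p is the (p+1)-st vertex), which is a
-- bijection, with v p → v q only if p < q.
IsAcyclicOrdering : ∀ {n m} → IceQuiver n m → (Fin n → Fin n) → Set
IsAcyclicOrdering Q v = Injective _≡_ _≡_ v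
  × (∀ p q → 0 < mArr Q (v p) (v q) → toℕ p < toℕ q)

UniqueAcyclicOrdering : ∀ {n m} → IceQuiver n m → (Fin n → Fin n) → Set
UniqueAcyclicOrdering Q v = IsAcyclicOrdering Q v
  × (∀ w → IsAcyclicOrdering Q w → ∀ p → w p ≡ v p)

-- w_j = [v₁, …, v_j]  (j given 0-based as a Fin n: the list v 0, …, v j)
wSeq : ∀ {n} → (Fin n → Fin n) → Fin n → List (Fin n)
wSeq v j = map (λ p → v (Data.Fin.inject≤ p (FinP.toℕ<n j))) (Data.List.allFin (suc (toℕ j)))

-- Mutating along v₁, …, v_j always mutates at a source of the full subquiver on
-- {v₁, …, v_j}: at time t the unmutated vertices v_t, …, v_j precede the mutated
-- ones, each block in its original order, so mutation only reverses arrows there.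
-- Fix a frozen f.  As v_j is red, v_j never gets an arrow to f, while each
-- mutation at v_t (t < j) adds at least P_t arrows f → v_j, where P_t is the number
-- of arrows f → v_t just before mutating at v_t.  Hence P_j ≥ P_i + (arrows f → v_j
-- in Q) for i < j.  The final mutation at v_j makes it green with P_j arrows to f,
-- and gives every earlier v_i at least P_j new arrows from f, which beats the at
-- most P_i arrows v_i → f that are left after mutating at v_i.

module Submission where

open import Defs
open import Data.Nat using (ℕ; zero; suc; _+_; _*_; _∸_; _≤_; _<_; _<ᵇ_; z≤n; s≤s; z<s; >-nonZero)
open import Data.Nat.Properties
open import Data.Fin using (Fin; toℕ; fromℕ<; inject≤)
open import Data.Fin.Properties using (toℕ<n; toℕ-injective; toℕ-fromℕ<; toℕ-inject≤; toℕ≤pred[n])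
open import Data.Bool using (Bool; true; false; not; _xor_)
open import Data.Bool.Properties using (xor-same; T-≡)
open import Data.Sum using (inj₁; inj₂)
open import Data.Product using (∃-syntax; _×_; _,_; proj₁; proj₂)
open import Data.List using (List; []; _∷_; _∷ʳ_; tabulate; applyUpTo)
open import Data.List.Properties using (map-tabulate; applyUpTo-∷ʳ)
open import Function using (_∘_; Equivalence)
open import Relation.Nullary using (yes; no; contradiction)
open import Relation.Binary using (tri<; tri≈; tri>)
open import Relation.Binary.PropositionalEquality

arr-mutate-from : ∀ {n m} (k : Fin n) (Q : IceQuiver n m) b →
  arr (mutate k Q) (inj₁ k) b ≡ arr Q b (inj₁ k)
arr-mutate-from k Q b = from (inj₁ k) refl
  where
  from : ∀ a → a ≡ inj₁ k → arr (mutate k Q) a b ≡ arr Q b a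
  from a a≡k with a ≟V inj₁ k | b ≟V inj₁ k
  ... | yes _   | _ = refl
  ... | no a≢k | _ = contradiction a≡k a≢k

arr-mutate-to : ∀ {n m} (k : Fin n) (Q : IceQuiver n m) a → a ≢ inj₁ k →
  arr (mutate k Q) a (inj₁ k) ≡ arr Q (inj₁ k) a
arr-mutate-to k Q a a≢k = to (inj₁ k) refl
  where
  to : ∀ b → b ≡ inj₁ k → arr (mutate k Q) a b ≡ arr Q b a
  to b b≡k with a ≟V inj₁ k | b ≟V inj₁ k
  ... | yes a≡k | _       = contradiction a≡k a≢k
  ... | no _    | yes _   = refl
  ... | no _    | no b≢k = contradiction b≡k b≢k

arr-mutate-away : ∀ {n m} (k : Fin n) (Q : IceQuiver n m) {a b} → a ≢ inj₁ k → b ≢ inj₁ k →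
  arr (mutate k Q) a b ≡
    (arr Q a b + arr Q a (inj₁ k) * arr Q (inj₁ k) b) ∸ (arr Q b a + arr Q b (inj₁ k) * arr Q (inj₁ k) a)
arr-mutate-away k Q {a} {b} a≢k b≢k with a ≟V inj₁ k | b ≟V inj₁ k
... | yes a≡k | _       = contradiction a≡k a≢k
... | no _    | yes b≡k = contradiction b≡k b≢k
... | no _    | no _    = refl

arr-mutate-of-nonpredecessor : ∀ {n m} (k : Fin n) (Q : IceQuiver n m) {a b} → a ≢ inj₁ k → b ≢ inj₁ k →
  arr Q a (inj₁ k) ≡ 0 →
  arr (mutate k Q) a b ≡ arr Q a b ∸ (arr Q b a + arr Q b (inj₁ k) * arr Q (inj₁ k) a)
arr-mutate-of-nonpredecessor k Q {a} {b} a≢k b≢k a↛k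
  rewrite arr-mutate-away k Q a≢k b≢k | a↛k | +-identityʳ (arr Q a b) = refl

arr-mutate-to-nonpredecessor : ∀ {n m} (k : Fin n) (Q : IceQuiver n m) {a b} → a ≢ inj₁ k → b ≢ inj₁ k →
  arr Q b (inj₁ k) ≡ 0 →
  arr (mutate k Q) a b ≡ (arr Q a b + arr Q a (inj₁ k) * arr Q (inj₁ k) b) ∸ arr Q b a
arr-mutate-to-nonpredecessor k Q {a} {b} a≢k b≢k b↛k
  rewrite arr-mutate-away k Q a≢k b≢k | b↛k | +-identityʳ (arr Q b a) = refl

arr-mutate-between-nonpredecessors : ∀ {n m} (k : Fin n) (Q : IceQuiver n m) {a b} → a ≢ inj₁ k → b ≢ inj₁ k →
  arr Q a (inj₁ k) ≡ 0 → arr Q b (inj₁ k) ≡ 0 → arr (mutate k Q) a b ≡ arr Q a b ∸ arr Q b a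
arr-mutate-between-nonpredecessors k Q {a} {b} a≢k b≢k a↛k b↛k
  rewrite arr-mutate-of-nonpredecessor k Q a≢k b≢k a↛k | b↛k | +-identityʳ (arr Q b a) = refl

red⇒inflow : ∀ {n m} {Q : IceQuiver n m} {i} → IsRed Q i → ∃[ f ] 0 < arr Q (inj₂ f) (inj₁ i)
red⇒inflow ((f , inj₁ out>0) , no-out) = contradiction (no-out f) (>⇒≢ out>0)
red⇒inflow ((f , inj₂ in>0) , _) = f , in>0

mutateAlong : ∀ {n m} → (ℕ → Fin n) → ℕ → IceQuiver n m → IceQuiver n m
mutateAlong u zero    Q = Q
mutateAlong u (suc t) Q = mutate (u t) (mutateAlong u t Q)

mutateSeq-∷ʳ : ∀ {n m} (ks : List (Fin n)) k (Q : IceQuiver n m) →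
  mutateSeq (ks ∷ʳ k) Q ≡ mutate k (mutateSeq ks Q)
mutateSeq-∷ʳ []       k Q = refl
mutateSeq-∷ʳ (k′ ∷ ks) k Q = mutateSeq-∷ʳ ks k (mutate k′ Q)

mutateSeq-applyUpTo : ∀ {n m} (u : ℕ → Fin n) t (Q : IceQuiver n m) →
  mutateSeq (applyUpTo u t) Q ≡ mutateAlong u t Q
mutateSeq-applyUpTo u zero    Q = refl
mutateSeq-applyUpTo u (suc t) Q = begin
  mutateSeq (applyUpTo u (suc t)) Q           ≡⟨ cong (λ ks → mutateSeq ks Q) (applyUpTo-∷ʳ u t) ⟨
  mutateSeq (applyUpTo u t ∷ʳ u t) Q          ≡⟨ mutateSeq-∷ʳ (applyUpTo u t) (u t) Q ⟩
  mutate (u t) (mutateSeq (applyUpTo u t) Q)  ≡⟨ cong (mutate (u t)) (mutateSeq-applyUpTo u t Q) ⟩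
  mutateAlong u (suc t) Q                     ∎
  where open ≡-Reasoning

tabulate-applyUpTo : ∀ {a} {A : Set a} {k} (f : Fin k → A) (g : ℕ → A) →
  (∀ p → f p ≡ g (toℕ p)) → tabulate f ≡ applyUpTo g k
tabulate-applyUpTo {k = zero}  f g f≗g = refl
tabulate-applyUpTo {k = suc k} f g f≗g =
  cong₂ _∷_ (f≗g Fin.zero) (tabulate-applyUpTo (f ∘ Fin.suc) (g ∘ suc) (f≗g ∘ Fin.suc))
  where import Data.Fin as Fin

<ᵇ-true : ∀ {p q} → p < q → (p <ᵇ q) ≡ true
<ᵇ-true p<q = Equivalence.to T-≡ (<⇒<ᵇ p<q)

<ᵇ-false : ∀ {p q} → q ≤ p → (p <ᵇ q) ≡ false
<ᵇ-false z≤n       = refl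
<ᵇ-false (s≤s q≤p) = <ᵇ-false q≤p

<ᵇ-irrefl : ∀ t → (t <ᵇ t) ≡ false
<ᵇ-irrefl t = <ᵇ-false {t} ≤-refl

<ᵇ-step : ∀ {p t} → p ≢ t → (p <ᵇ suc t) ≡ (p <ᵇ t)
<ᵇ-step {p} {t} p≢t with <-cmp p t
... | tri< p<t _ _ rewrite <ᵇ-true p<t = <ᵇ-true (m<n⇒m<1+n p<t)
... | tri≈ _ p≡t _ = contradiction p≡t p≢t
... | tri> _ _ t<p rewrite <ᵇ-false (<⇒≤ t<p) = <ᵇ-false t<p

<ᵇ-flip : ∀ {p q} → p ≢ q → (q <ᵇ p) ≡ not (p <ᵇ q)
<ᵇ-flip {p} {q} p≢q with <-cmp p q
... | tri< p<q _ _ rewrite <ᵇ-true p<q = <ᵇ-false (<⇒≤ p<q)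
... | tri≈ _ p≡q _ = contradiction p≡q p≢q
... | tri> _ _ q<p rewrite <ᵇ-true q<p | <ᵇ-false (<⇒≤ q<p) = refl

-- Orientation of the arrow between the p-th and q-th vertex of the chain after t
-- mutations: the unmutated block (p ≥ t) precedes the mutated one (p < t).
forwardAt : ℕ → ℕ → ℕ → Bool
forwardAt t p q = ((p <ᵇ q) xor (p <ᵇ t)) xor (q <ᵇ t)

forwardAt-zero-< : ∀ {p q} → p < q → forwardAt 0 p q ≡ true
forwardAt-zero-< p<q rewrite <ᵇ-true p<q = refl

forwardAt-zero-> : ∀ {p q} → q < p → forwardAt 0 p q ≡ false
forwardAt-zero-> q<p rewrite <ᵇ-false (<⇒≤ q<p) = refl

forwardAt-into-source : ∀ t p → forwardAt t p t ≡ false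
forwardAt-into-source t p rewrite xor-same (p <ᵇ t) | <ᵇ-irrefl t = refl

forwardAt-out-of-source : ∀ {t p} → p ≢ t → forwardAt t t p ≡ true
forwardAt-out-of-source {t} {p} p≢t rewrite <ᵇ-irrefl t | <ᵇ-flip p≢t with p <ᵇ t
... | true  = refl
... | false = refl

forwardAt-out-of-sink : ∀ {t q} → q ≢ t → forwardAt (suc t) t q ≡ false
forwardAt-out-of-sink {t} {q} q≢t
  rewrite <ᵇ-true (n<1+n t) | <ᵇ-step q≢t | <ᵇ-flip q≢t with q <ᵇ t
... | true  = refl
... | false = refl

forwardAt-into-sink : ∀ {t p} → p ≢ t → forwardAt (suc t) p t ≡ true
forwardAt-into-sink {t} {p} p≢t rewrite <ᵇ-true (n<1+n t) | <ᵇ-step p≢t | xor-same (p <ᵇ t) = refl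

forwardAt-unchanged : ∀ {t p q} → p ≢ t → q ≢ t → forwardAt (suc t) p q ≡ forwardAt t p q
forwardAt-unchanged p≢t q≢t rewrite <ᵇ-step p≢t | <ᵇ-step q≢t = refl

forwardAt-flip : ∀ t {p q} → p ≢ q → forwardAt t q p ≡ not (forwardAt t p q)
forwardAt-flip t {p} {q} p≢q rewrite <ᵇ-flip p≢q with p <ᵇ q | p <ᵇ t | q <ᵇ t
... | true  | true  | true  = refl
... | true  | true  | false = refl
... | true  | false | true  = refl
... | true  | false | false = refl
... | false | true  | true  = refl
... | false | true  | false = refl
... | false | false | true  = refl
... | false | false | false = refl

PositiveIff : Bool → ℕ → Set
PositiveIff true  x = 0 < x
PositiveIff false x = x ≡ 0

positiveIff-∸ : ∀ b {x y} → PositiveIff b x → PositiveIff (not b) y → PositiveIff b (x ∸ y)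
positiveIff-∸ true  x>0 refl = x>0
positiveIff-∸ false {y = y} refl _ = 0∸n≡0 y

IsForwardChain : ∀ {n m} → IceQuiver n m → (ℕ → Fin n) → ℕ → Set
IsForwardChain Q u J = ∀ {p q} → p < q → q ≤ J → 0 < mArr Q (u p) (u q) × mArr Q (u q) (u p) ≡ 0

module ForwardChain {n m} (Q : IceQuiver n m) (u : ℕ → Fin n) (J : ℕ) (forward : IsForwardChain Q u J) where

  U : ℕ → Vertex n m
  U t = inj₁ (u t)

  Qs : ℕ → IceQuiver n m
  Qs t = mutateAlong u t Q

  A : ℕ → Vertex n m → Vertex n m → ℕ
  A t = arr (Qs t)

  U-injective-< : ∀ {p q} → p < q → q ≤ J → U p ≢ U q
  U-injective-< {p} {q} p<q q≤J Up≡Uq = <-irrefl (sym loop≡0) loop>0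
    where
    loop>0 : 0 < A 0 (U q) (U q)
    loop>0 = subst (λ x → 0 < A 0 x (U q)) Up≡Uq (proj₁ (forward p<q q≤J))
    loop≡0 : A 0 (U q) (U q) ≡ 0
    loop≡0 = subst (λ x → A 0 (U q) x ≡ 0) Up≡Uq (proj₂ (forward p<q q≤J))

  U-injective : ∀ {p q} → p ≤ J → q ≤ J → p ≢ q → U p ≢ U q
  U-injective {p} {q} p≤J q≤J p≢q with <-cmp p q
  ... | tri< p<q _ _ = U-injective-< p<q q≤J
  ... | tri≈ _ p≡q _ = contradiction p≡q p≢q
  ... | tri> _ _ q<p = U-injective-< q<p p≤J ∘ sym

  Oriented : ℕ → Set
  Oriented t = ∀ p q → p ≤ J → q ≤ J → p ≢ q → PositiveIff (forwardAt t p q) (A t (U p) (U q))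

  oriented-zero : Oriented 0
  oriented-zero p q p≤J q≤J p≢q with <-cmp p q
  ... | tri< p<q _ _ = subst (λ b → PositiveIff b (A 0 (U p) (U q))) (sym (forwardAt-zero-< p<q)) (proj₁ (forward p<q q≤J))
  ... | tri≈ _ p≡q _ = contradiction p≡q p≢q
  ... | tri> _ _ q<p = subst (λ b → PositiveIff b (A 0 (U p) (U q))) (sym (forwardAt-zero-> q<p)) (proj₂ (forward q<p p≤J))

  source-in : ∀ {t p} → t ≤ J → Oriented t → p ≤ J → p ≢ t → A t (U p) (U t) ≡ 0
  source-in {t} {p} t≤J o p≤J p≢t = subst (λ b → PositiveIff b (A t (U p) (U t))) (forwardAt-into-source t p) (o p t p≤J t≤J p≢t)

  source-out : ∀ {t p} → t ≤ J → Oriented t → p ≤ J → p ≢ t → 0 < A t (U t) (U p)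
  source-out {t} {p} t≤J o p≤J p≢t = subst (λ b → PositiveIff b (A t (U t) (U p))) (forwardAt-out-of-source p≢t) (o _ _ t≤J p≤J (p≢t ∘ sym))

  oriented-suc : ∀ {t} → t ≤ J → Oriented t → Oriented (suc t)
  oriented-suc {t} t≤J o p q p≤J q≤J p≢q with p ≟ t | q ≟ t
  ... | yes refl | yes refl = contradiction refl p≢q
  ... | yes refl | no q≢t  = subst₂ PositiveIff (sym (forwardAt-out-of-sink q≢t))
                               (sym (arr-mutate-from (u t) (Qs t) (U q))) (source-in t≤J o q≤J q≢t)
  ... | no p≢t  | yes refl = subst₂ PositiveIff (sym (forwardAt-into-sink p≢t))
                               (sym (arr-mutate-to (u t) (Qs t) (U p) (U-injective p≤J t≤J p≢t)))
                               (source-out t≤J o p≤J p≢t)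
  ... | no p≢t  | no q≢t  = subst₂ PositiveIff (sym (forwardAt-unchanged p≢t q≢t))
                               (sym (arr-mutate-between-nonpredecessors (u t) (Qs t)
                                  (U-injective p≤J t≤J p≢t) (U-injective q≤J t≤J q≢t)
                                  (source-in t≤J o p≤J p≢t) (source-in t≤J o q≤J q≢t)))
                               (positiveIff-∸ (forwardAt t p q) (o p q p≤J q≤J p≢q)
                                  (subst (λ b → PositiveIff b (A t (U q) (U p))) (forwardAt-flip t p≢q) (o q p q≤J p≤J (p≢q ∘ sym))))

  oriented : ∀ t → t ≤ J → Oriented t
  oriented zero    _   = oriented-zero
  oriented (suc t) t<J = oriented-suc (<⇒≤ t<J) (oriented t (<⇒≤ t<J))

  module Frozen (f : Fin m) (last↛f : A 0 (U J) (inj₂ f) ≡ 0) where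

    F : Vertex n m
    F = inj₂ f

    outflow inflow : ℕ → ℕ → ℕ
    outflow t b = A t (U b) F
    inflow  t b = A t F (U b)

    P : ℕ → ℕ
    P t = inflow t t

    outflow-suc : ∀ {t b} → t ≤ J → b ≤ J → b ≢ t →
      outflow (suc t) b ≡ outflow t b ∸ (inflow t b + P t * A t (U t) (U b))
    outflow-suc {t} {b} t≤J b≤J b≢t = arr-mutate-of-nonpredecessor (u t) (Qs t) (U-injective b≤J t≤J b≢t) (λ ())
      (source-in t≤J (oriented t t≤J) b≤J b≢t)

    inflow-suc : ∀ {t b} → t ≤ J → b ≤ J → b ≢ t →
      inflow (suc t) b ≡ (inflow t b + P t * A t (U t) (U b)) ∸ outflow t b
    inflow-suc {t} {b} t≤J b≤J b≢t = arr-mutate-to-nonpredecessor (u t) (Qs t) {F} (λ ()) (U-injective b≤J t≤J b≢t)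
      (source-in t≤J (oriented t t≤J) b≤J b≢t)

    outflow-last : ∀ t → t ≤ J → outflow t J ≡ 0
    outflow-last zero    _   = last↛f
    outflow-last (suc t) t<J = begin
      outflow (suc t) J       ≡⟨ outflow-suc (<⇒≤ t<J) ≤-refl (>⇒≢ t<J) ⟩
      outflow t J ∸ removed   ≡⟨ cong (_∸ removed) (outflow-last t (<⇒≤ t<J)) ⟩
      0 ∸ removed             ≡⟨ 0∸n≡0 removed ⟩
      0                       ∎
      where
      open ≡-Reasoning
      removed = inflow t J + P t * A t (U t) (U J)

    inflow-last-suc : ∀ {t} → t < J → inflow t J + P t ≤ inflow (suc t) J
    inflow-last-suc {t} t<J = begin
      inflow t J + P t                       ≤⟨ +-monoʳ-≤ (inflow t J) (m≤m*n (P t) a {{>-nonZero a>0}}) ⟩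
      inflow t J + P t * a                   ≡⟨ cong (inflow t J + P t * a ∸_) (outflow-last t (<⇒≤ t<J)) ⟨
      (inflow t J + P t * a) ∸ outflow t J   ≡⟨ inflow-suc (<⇒≤ t<J) ≤-refl (>⇒≢ t<J) ⟨
      inflow (suc t) J                       ∎
      where
      open ≤-Reasoning
      a = A t (U t) (U J)
      a>0 : 0 < a
      a>0 = source-out (<⇒≤ t<J) (oriented t (<⇒≤ t<J)) ≤-refl (>⇒≢ t<J)

    inflow-last-mono : ∀ {s t} → s ≤ t → t ≤ J → inflow s J ≤ inflow t J
    inflow-last-mono {s} {zero}  z≤n   _   = ≤-refl
    inflow-last-mono {s} {suc t} s≤1+t t<J with m≤n⇒m<n∨m≡n s≤1+t
    ... | inj₂ refl      = ≤-refl
    ... | inj₁ (s≤s s≤t) = ≤-trans (inflow-last-mono s≤t (<⇒≤ t<J))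
                             (≤-trans (m≤m+n (inflow t J) (P t)) (inflow-last-suc t<J))

    inflow-increments : ∀ {i} → i < J → inflow 0 J + P i ≤ P J
    inflow-increments {i} i<J = begin
      inflow 0 J + P i  ≤⟨ +-monoˡ-≤ (P i) (inflow-last-mono z≤n (<⇒≤ i<J)) ⟩
      inflow i J + P i  ≤⟨ inflow-last-suc i<J ⟩
      inflow (suc i) J  ≤⟨ inflow-last-mono i<J ≤-refl ⟩
      P J               ∎
      where open ≤-Reasoning

    -- After the mutation at u_i, the arrows u_i → f number P_i and only decrease.
    outflow-bounded : ∀ {i t} → i < t → t ≤ J → outflow t i ≤ P i
    outflow-bounded {i} {suc t} (s≤s i≤t) t<J with i ≟ t
    ... | yes refl = ≤-reflexive (arr-mutate-from (u i) (Qs i) F)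
    ... | no i≢t  = begin
      outflow (suc t) i         ≡⟨ outflow-suc (<⇒≤ t<J) (≤-trans i≤t (<⇒≤ t<J)) i≢t ⟩
      outflow t i ∸ removed     ≤⟨ m∸n≤m (outflow t i) removed ⟩
      outflow t i               ≤⟨ outflow-bounded (≤∧≢⇒< i≤t i≢t) (<⇒≤ t<J) ⟩
      P i                       ∎
      where
      open ≤-Reasoning
      removed = inflow t i + P t * A t (U t) (U i)

    outflow-dominated : ∀ {i} → i < J → inflow 0 J + outflow J i ≤ inflow J i + P J * A J (U J) (U i)
    outflow-dominated {i} i<J = begin
      inflow 0 J + outflow J i  ≤⟨ +-monoʳ-≤ (inflow 0 J) (outflow-bounded i<J ≤-refl) ⟩
      inflow 0 J + P i          ≤⟨ inflow-increments i<J ⟩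
      P J                       ≤⟨ m≤m*n (P J) a {{>-nonZero a>0}} ⟩
      P J * a                   ≤⟨ m≤n+m (P J * a) (inflow J i) ⟩
      inflow J i + P J * a      ∎
      where
      open ≤-Reasoning
      a = A J (U J) (U i)
      a>0 : 0 < a
      a>0 = source-out ≤-refl (oriented J ≤-refl) (<⇒≤ i<J) (<⇒≢ i<J)

    outflow-cleared : ∀ {i} → i < J → outflow (suc J) i ≡ 0
    outflow-cleared i<J = trans (outflow-suc ≤-refl (<⇒≤ i<J) (<⇒≢ i<J))
      (m≤n⇒m∸n≡0 (≤-trans (m≤n+m _ (inflow 0 J)) (outflow-dominated i<J)))

    inflow-created : ∀ {i} → i < J → 0 < inflow 0 J → 0 < inflow (suc J) i
    inflow-created i<J in>0 = subst (0 <_) (sym (inflow-suc ≤-refl (<⇒≤ i<J) (<⇒≢ i<J)))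
      (m<n⇒0<n∸m (<-≤-trans (m<n+m _ in>0) (outflow-dominated i<J)))

    outflow-last-final : outflow (suc J) J ≡ P J
    outflow-last-final = arr-mutate-from (u J) (Qs J) F

    inflow-last-final : inflow (suc J) J ≡ 0
    inflow-last-final = trans (arr-mutate-to (u J) (Qs J) F (λ ())) (outflow-last J ≤-refl)

  module _ (last-red : IsRed Q (u J)) where

    private
      f₀ : Fin m
      f₀ = proj₁ (red⇒inflow {Q = Q} last-red)
      inflow>0 : 0 < A 0 (inj₂ f₀) (U J)
      inflow>0 = proj₂ (red⇒inflow {Q = Q} last-red)
      module F (f : Fin m) = Frozen f (proj₂ last-red f)

    red-before-last : ∀ {i} → i < J → IsRed (mutateAlong u (suc J) Q) (u i)
    red-before-last i<J = (f₀ , inj₂ (F.inflow-created f₀ i<J inflow>0)) , λ f → F.outflow-cleared f i<J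

    green-last : IsGreen (mutateAlong u (suc J) Q) (u J)
    green-last = (f₀ , inj₁ outflow>0) , F.inflow-last-final
      where
      outflow>0 : 0 < A (suc J) (U J) (inj₂ f₀)
      outflow>0 = subst (0 <_) (sym (F.outflow-last-final f₀))
        (<-≤-trans inflow>0 (F.inflow-last-mono f₀ z≤n ≤-refl))

-- Reindexing the vertices v₀,…,v_j by ℕ; indices beyond j are sent to v_j.
clamp : ∀ {n} → Fin n → ℕ → Fin n
clamp j t = fromℕ< (m<n⇒o⊓m<n t (toℕ<n j))

toℕ-clamp : ∀ {n} (j : Fin n) {t} → t ≤ toℕ j → toℕ (clamp j t) ≡ t
toℕ-clamp j t≤j = trans (toℕ-fromℕ< _) (m≤n⇒m⊓n≡m t≤j)

clamp-toℕ : ∀ {n} (j i : Fin n) → toℕ i ≤ toℕ j → clamp j (toℕ i) ≡ i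
clamp-toℕ j i i≤j = toℕ-injective (toℕ-clamp j i≤j)

acyclicOrdering⇒forwardChain : ∀ {n m} {Q : IceQuiver n m} {v} → Abundant Q → IsAcyclicOrdering Q v →
  (j : Fin n) → IsForwardChain Q (v ∘ clamp j) (toℕ j)
acyclicOrdering⇒forwardChain {Q = Q} {v} abundant (v-injective , v-ordered) j {p} {q} p<q q≤j =
  <-≤-trans z<s (subst (2 ≤_) (trans (cong (forth +_) back≡0) (+-identityʳ forth)) (abundant _ _ distinct))
  , back≡0
  where
  forth = mArr Q (v (clamp j p)) (v (clamp j q))
  toℕ-p = toℕ-clamp j (≤-trans (<⇒≤ p<q) q≤j)
  toℕ-q = toℕ-clamp j q≤j
  back≡0 : mArr Q (v (clamp j q)) (v (clamp j p)) ≡ 0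
  back≡0 = n≤0⇒n≡0 (≮⇒≥ λ back>0 → <-asym p<q (subst₂ _<_ toℕ-q toℕ-p (v-ordered _ _ back>0)))
  distinct : v (clamp j p) ≢ v (clamp j q)
  distinct vp≡vq = <⇒≢ p<q (trans (sym toℕ-p) (trans (cong toℕ (v-injective vp≡vq)) toℕ-q))

wSeq≡applyUpTo : ∀ {n} (v : Fin n → Fin n) j → wSeq v j ≡ applyUpTo (v ∘ clamp j) (suc (toℕ j))
wSeq≡applyUpTo v j = trans (map-tabulate (λ p → p) vertex)
  (tabulate-applyUpTo vertex (v ∘ clamp j) λ p → cong v (toℕ-injective
    (trans (toℕ-inject≤ p (toℕ<n j)) (sym (toℕ-clamp j (toℕ≤pred[n] p))))))
  where
  vertex : Fin (suc (toℕ j)) → Fin _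
  vertex p = v (inject≤ p (toℕ<n j))

lemma4p4 : ∀ {n m} (Q : IceQuiver n m) (v : Fin n → Fin n) → IsQuiver Q
    → UniformlySignCoherent Q → Abundant Q → Acyclic Q → UniqueAcyclicOrdering Q v
    → ∀ (j : Fin n) → IsRed Q (v j)
    → (∀ (i : Fin n) → toℕ i < toℕ j → IsRed (mutateSeq (wSeq v j) Q) (v i))
    × IsGreen (mutateSeq (wSeq v j) Q) (v j)
lemma4p4 Q v _ _ abundant _ (ordering , _) j vj-red =
  (λ i i<j → subst₂ IsRed (sym mutations) (cong v (clamp-toℕ j i (<⇒≤ i<j))) (red-before-last last-red i<j))
  , subst₂ IsGreen (sym mutations) (cong v (clamp-toℕ j j ≤-refl)) (green-last last-red)
  where
  u = v ∘ clamp j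
  open ForwardChain Q u (toℕ j) (acyclicOrdering⇒forwardChain {Q = Q} abundant ordering j)
  mutations : mutateSeq (wSeq v j) Q ≡ mutateAlong u (suc (toℕ j)) Q
  mutations = trans (cong (λ ks → mutateSeq ks Q) (wSeq≡applyUpTo v j)) (mutateSeq-applyUpTo u _ Q)
  last-red : IsRed Q (u (toℕ j))
  last-red = subst (IsRed Q) (cong v (sym (clamp-toℕ j j ≤-refl))) vj-red
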